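{- Let $n\ge 2$, $p\in\{1,\dots,n-1\}$, $C_i,\overline{c}_i\geq 0$ for $i\in[n]$, and $\theta\ge 0$. Let $G_\theta$ be the network with node set $\{s,t,x_1,\dots,x_n,y_1,\dots,y_n\}$ and arcs $(s,x_i)$ and $(y_i,t)$ for $i\in[n]$ and $(x_i,y_j)$ for all $i,j\in[n]$, all of capacity $1$; the costs of $(s,x_i)$ and $(y_i,t)$ are $0$, the cost of $(x_i,y_i)$ is $C_i+\overline{c}_i-\theta$, and the cost of $(x_i,y_j)$ for $i\neq j$ is $C_i+\overline{c}_j$; node $s$ has supply $p$ and node $t$ has demand $p$. Let $E_X,E_Y,E_Z\subseteq[n]$ be pairwise disjoint sets with $|E_X|+|E_Z|=|E_Y|+|E_Z|=p$ such that the $0$-$1$ vector with $x_i=1$ iff $i\in E_X$, $y_i=1$ iff $i\in E_Y$, $z_i=1$ iff $i\in E_Z$ is an optimal solution of the linear program $\min \sum_i C_i x_i+\sum_i\overline{c}_i y_i+\sum_i(C_i+\overline{c}_i-\theta)z_i+(p-k)\theta$ subject to $\sum_i x_i+\sum_i z_i=p$, $\sum_i y_i+\sum_i z_i=p$, $x_i+z_i\le 1$, $y_i+z_i\le 1$, $x_i,y_i,z_i\ge 0$ (for some $k\in\{0,\dots,p\}$). Let $f_\theta$ be the flow in $G_\theta$ obtained by sending one unit along $s\to x_i\to y_i\to t$ for each $i\in E_Z$, and, for an arbitrary bijection pairing the elements $i\in E_X$ with elements $j\in E_Y$, one unit along $s\to x_i\to y_j\to t$ for each pair $(i,j)$. Let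 $G^r_\theta$ be the residual network of $G_\theta$ with respect to $f_\theta$ (each arc carrying no flow remains with its cost; each arc carrying one unit of flow is replaced by its reverse with negated cost). Let $\mathcal{F}$ be the set of arcs of $G^r_\theta$ of the form $(x_i,y_i)$. Then each simple directed cycle in $G^r_\theta$ contains at most two arcs from $\mathcal{F}$.
   Formalization: The costs $C_i$, $\overline{c}_i$ and the parameter $\theta$ are rational, and the variables of the linear program, against which optimality of the 0-1 vector is tested, are taken in ℚ. -}

module Defs where

open import Data.Nat as ℕ using (ℕ; zero; suc)
open import Data.Integer using (+_)
open import Data.Rational using (ℚ; 0ℚ; 1ℚ; _+_; _*_; _-_; _≤_; _/_)
open import Data.Bool using (Bool; true; false; if_then_else_; _∧_; _∨_)
open import Data.Fin using (Fin; zero; suc; inject₁; fromℕ)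
open import Data.Fin.Subset using (Subset; _∈_)
open import Data.Vec using (lookup)
open import Data.Product using (_×_; ∃-syntax)
open import Relation.Binary.PropositionalEquality using (_≡_)
open import Relation.Nullary.Decidable using (⌊_⌋)
import Data.Fin.Properties as FinP

sumF : ∀ {n} → (Fin n → ℚ) → ℚ
sumF {zero}  f = 0ℚ
sumF {suc n} f = f zero + sumF (λ i → f (suc i))

sumℕ : ∀ {n} → (Fin n → ℕ) → ℕ
sumℕ {zero}  f = 0
sumℕ {suc n} f = f zero ℕ.+ sumℕ (λ i → f (suc i))

ℕtoℚ : ℕ → ℚ
ℕtoℚ m = + m / 1

χ : ∀ {n} → Subset n → Fin n → ℚ
χ E i = if lookup E i then 1ℚ else 0ℚ

Feasible : ∀ {n} (p : ℕ) (x y z : Fin n → ℚ) → Set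
Feasible {n} p x y z =
  (sumF x + sumF z ≡ ℕtoℚ p) ×
  (sumF y + sumF z ≡ ℕtoℚ p) ×
  (∀ i → x i + z i ≤ 1ℚ) ×
  (∀ i → y i + z i ≤ 1ℚ) ×
  (∀ i → 0ℚ ≤ x i) × (∀ i → 0ℚ ≤ y i) × (∀ i → 0ℚ ≤ z i)

objective : ∀ {n} (p k : ℕ) (C cbar : Fin n → ℚ) (θ : ℚ) (x y z : Fin n → ℚ) → ℚ
objective p k C cbar θ x y z =
  sumF (λ i → C i * x i) + sumF (λ i → cbar i * y i)
  + sumF (λ i → (C i + cbar i - θ) * z i) + (ℕtoℚ p - ℕtoℚ k) * θ

Optimal : ∀ {n} (p k : ℕ) (C cbar : Fin n → ℚ) (θ : ℚ) (x y z : Fin n → ℚ) → Set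
Optimal {n} p k C cbar θ x y z =
  Feasible p x y z ×
  (∀ (x′ y′ z′ : Fin n → ℚ) → Feasible p x′ y′ z′ →
     objective p k C cbar θ x y z ≤ objective p k C cbar θ x′ y′ z′)

data Node (n : ℕ) : Set where
  s t : Node n
  xN yN : Fin n → Node n

-- arcs of G_θ (all of capacity 1)
data Arc (n : ℕ) : Set where
  sx : Fin n → Arc n
  yt : Fin n → Arc n
  xy : Fin n → Fin n → Arc n

tail head : ∀ {n} → Arc n → Node n
tail (sx i)   = s
tail (yt i)   = yN i
tail (xy i j) = xN i
head (sx i)   = xN i
head (yt i)   = t
head (xy i j) = yN j

cost : ∀ {n} (C cbar : Fin n → ℚ) (θ : ℚ) → Arc n → ℚ
cost C cbar θ (sx i)   = 0ℚ
cost C cbar θ (yt i)   = 0ℚ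
cost C cbar θ (xy i j) =
  if ⌊ i FinP.≟ j ⌋ then C i + cbar i - θ else C i + cbar j

-- A pairing of E_X with E_Y: a map σ restricting to a bijection E_X → E_Y
-- (its values outside E_X are irrelevant).
IsPairing : ∀ {n} (EX EY : Subset n) (σ : Fin n → Fin n) → Set
IsPairing EX EY σ =
  (∀ i → i ∈ EX → σ i ∈ EY) ×
  (∀ i j → i ∈ EX → j ∈ EX → σ i ≡ σ j → i ≡ j) ×
  (∀ j → j ∈ EY → ∃[ i ] (i ∈ EX × σ i ≡ j))

flow : ∀ {n} (EX EY EZ : Subset n) (σ : Fin n → Fin n) → Arc n → Bool
flow EX EY EZ σ (sx i)   = lookup EX i ∨ lookup EZ i
flow EX EY EZ σ (yt j)   = lookup EY j ∨ lookup EZ j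
flow EX EY EZ σ (xy i j) =
  (lookup EZ i ∧ ⌊ i FinP.≟ j ⌋) ∨ (lookup EX i ∧ ⌊ σ i FinP.≟ j ⌋)

data ResArc {n} (EX EY EZ : Subset n) (σ : Fin n → Fin n) : Node n → Node n → Set where
  fwd : (a : Arc n) → flow EX EY EZ σ a ≡ false → ResArc EX EY EZ σ (tail a) (head a)
  bwd : (a : Arc n) → flow EX EY EZ σ a ≡ true  → ResArc EX EY EZ σ (head a) (tail a)

resCost : ∀ {n} {EX EY EZ : Subset n} {σ : Fin n → Fin n} (C cbar : Fin n → ℚ) (θ : ℚ)
          {u v : Node n} → ResArc EX EY EZ σ u v → ℚ
resCost C cbar θ (fwd a _) = cost C cbar θ a
resCost C cbar θ (bwd a _) = 0ℚ - cost C cbar θ a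

isF : ∀ {n} → Node n → Node n → Bool
isF (xN i) (yN j) = ⌊ i FinP.≟ j ⌋
isF _      _      = false

record SimpleCycle {n} (EX EY EZ : Subset n) (σ : Fin n → Fin n) : Set where
  field
    m       : ℕ
    vtx     : Fin (suc m) → Node n
    vtx-inj : ∀ a b → vtx a ≡ vtx b → a ≡ b
    step    : (k : Fin m) → ResArc EX EY EZ σ (vtx (inject₁ k)) (vtx (suc k))
    close   : ResArc EX EY EZ σ (vtx (fromℕ m)) (vtx zero)

countF : ∀ {n} {EX EY EZ : Subset n} {σ : Fin n → Fin n} → SimpleCycle EX EY EZ σ → ℕ
countF {n} cyc =
  sumℕ (λ (k : Fin m) → if isF (vtx (inject₁ k)) (vtx (suc k)) then 1 else 0)
  ℕ.+ (if isF (vtx (fromℕ m)) (vtx zero) then 1 else 0)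
  where open SimpleCycle cyc

-- The argument is purely combinatorial.  An arc (x_i , y_i)
-- of G^r_θ is a forward arc, so it carries no flow; in particular i ∉ E_Z.
--  * If i ∉ E_X, then x_i receives no flow, hence the only residual arc
--    entering x_i is (s , x_i): the cycle reaches x_i directly from s.
--  * If i ∈ E_X, then i ∉ E_Y by disjointness, so y_i sends no flow, hence
--    the only residual arc leaving y_i is (y_i , t): the cycle leaves y_i
--    directly to t.
-- A simple cycle visits s and t at most once each, so at most one of its
-- 𝓕-arcs is of the first kind and at most one of the second kind.
module Submission where

open import Defs
open import Data.Nat as ℕ using (ℕ; _+_; _≤_; _<_; z≤n; s≤s)
import Data.Nat.Properties as ℕP
open import Data.Rational using (ℚ; 0ℚ) renaming (_≤_ to _≤ℚ_)
open import Data.Fin using (Fin; zero; suc; inject₁; fromℕ)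
import Data.Fin.Properties as FinP
open import Data.Fin.Relation.Unary.Top using (view; ‵fromℕ; ‵inject₁)
open import Data.Fin.Subset using (Subset; ∣_∣; _∩_; Empty)
open import Data.Fin.Subset.Properties using (x∈p∩q⁺)
open import Data.Vec using (lookup)
open import Data.Vec.Properties using ([]=⇒lookup; lookup⇒[]=)
open import Data.Bool using (Bool; true; false; if_then_else_)
open import Data.Bool.Properties using (T-≡)
open import Data.Product using (_,_; proj₁; ∃-syntax; _×_)
open import Data.Sum using (_⊎_; inj₁; inj₂)
open import Data.Empty using (⊥-elim)
open import Function.Bundles using (Equivalence)
open import Relation.Nullary using (¬_; yes; no)
open import Relation.Nullary.Decidable using (toWitness)
open import Relation.Binary.PropositionalEquality using (_≡_; refl; sym; trans; cong; subst)

count : ∀ {n} → (Fin n → Bool) → ℕ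
count b = sumℕ (λ k → if b k then 1 else 0)

AtMostOne : ∀ {n} → (Fin n → Set) → Set
AtMostOne P = ∀ k k′ → P k → P k′ → k ≡ k′

atMostOne-suc : ∀ {n} {P : Fin (ℕ.suc n) → Set} → AtMostOne P → AtMostOne (λ k → P (suc k))
atMostOne-suc uniq k k′ p p′ = FinP.suc-injective (uniq (suc k) (suc k′) p p′)

count-none : ∀ {n} (b : Fin n → Bool) → (∀ k → ¬ b k ≡ true) → count b ≡ 0
count-none {ℕ.zero}  b none = refl
count-none {ℕ.suc n} b none with b zero in b₀
... | true  = ⊥-elim (none zero b₀)
... | false = count-none (λ k → b (suc k)) (λ k → none (suc k))

count-atMostOne : ∀ {n} (b : Fin n → Bool) (P : Fin n → Set) →
  (∀ k → b k ≡ true → P k) → AtMostOne P → count b ≤ 1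
count-atMostOne {ℕ.zero}  b P flag⇒P uniq = z≤n
count-atMostOne {ℕ.suc n} b P flag⇒P uniq with b zero in b₀
... | true  = ℕP.≤-reflexive (cong ℕ.suc (count-none (λ k → b (suc k)) zero-only))
  where
    zero-only : ∀ k → ¬ b (suc k) ≡ true
    zero-only k bₖ with () ← uniq zero (suc k) (flag⇒P zero b₀) (flag⇒P (suc k) bₖ)
... | false = count-atMostOne (λ k → b (suc k)) (λ k → P (suc k))
                (λ k → flag⇒P (suc k)) (atMostOne-suc uniq)

count-atMostTwo : ∀ {n} (b : Fin n → Bool) (P Q : Fin n → Set) →
  (∀ k → b k ≡ true → P k ⊎ Q k) → AtMostOne P → AtMostOne Q → count b ≤ 2
count-atMostTwo {ℕ.zero}  b P Q flag⇒P⊎Q uniqP uniqQ = z≤n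
count-atMostTwo {ℕ.suc n} b P Q flag⇒P⊎Q uniqP uniqQ with b zero in b₀
... | false = count-atMostTwo (λ k → b (suc k)) (λ k → P (suc k)) (λ k → Q (suc k))
                (λ k → flag⇒P⊎Q (suc k)) (atMostOne-suc uniqP) (atMostOne-suc uniqQ)
... | true with flag⇒P⊎Q zero b₀
...   | inj₁ p₀ = s≤s (count-atMostOne (λ k → b (suc k)) (λ k → Q (suc k))
                        onlyQ (atMostOne-suc uniqQ))
  where
    onlyQ : ∀ k → b (suc k) ≡ true → Q (suc k)
    onlyQ k bₖ with flag⇒P⊎Q (suc k) bₖ
    ... | inj₂ q = q
    ... | inj₁ p with () ← uniqP zero (suc k) p₀ p
...   | inj₂ q₀ = s≤s (count-atMostOne (λ k → b (suc k)) (λ k → P (suc k))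
                        onlyP (atMostOne-suc uniqP))
  where
    onlyP : ∀ k → b (suc k) ≡ true → P (suc k)
    onlyP k bₖ with flag⇒P⊎Q (suc k) bₖ
    ... | inj₁ p = p
    ... | inj₂ q with () ← uniqQ zero (suc k) q₀ q

prev : ∀ {m} → Fin (ℕ.suc m) → Fin (ℕ.suc m)
prev {m} zero = fromℕ m
prev (suc j)  = inject₁ j

prev-injective : ∀ {m} (a b : Fin (ℕ.suc m)) → prev a ≡ prev b → a ≡ b
prev-injective zero    zero    _  = refl
prev-injective zero    (suc j) eq = ⊥-elim (FinP.fromℕ≢inject₁ eq)
prev-injective (suc i) zero    eq = ⊥-elim (FinP.fromℕ≢inject₁ (sym eq))
prev-injective (suc i) (suc j) eq = cong suc (FinP.inject₁-injective eq)

prev-surjective : ∀ {m} (i : Fin (ℕ.suc m)) → ∃[ j ] prev j ≡ i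
prev-surjective i with view i
... | ‵fromℕ     = zero , refl
... | ‵inject₁ j = suc j , refl

disjoint : ∀ {n} {A B : Subset n} → Empty (A ∩ B) →
           ∀ i → lookup A i ≡ true → lookup B i ≡ false
disjoint {A = A} {B} empty i iA with lookup B i in iB
... | false = refl
... | true  = ⊥-elim (empty (i , x∈p∩q⁺ (lookup⇒[]= i A iA , lookup⇒[]= i B iB)))

module Residual {n : ℕ} (EX EY EZ : Subset n) (σ : Fin n → Fin n) where

  Res : Node n → Node n → Set
  Res = ResArc EX EY EZ σ

  flow-source : ∀ {i j} → flow EX EY EZ σ (xy i j) ≡ true →
                lookup EX i ≡ true ⊎ lookup EZ i ≡ true
  flow-source {i} {j} e with lookup EZ i | lookup EX i
  ... | true  | _     = inj₂ refl
  ... | false | true  = inj₁ refl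
  ... | false | false with () ← e

  flow-target : IsPairing EX EY σ → ∀ {i j} → flow EX EY EZ σ (xy i j) ≡ true →
                lookup EY j ≡ true ⊎ lookup EZ j ≡ true
  flow-target pairing {i} {j} e with lookup EZ i in iZ | i FinP.≟ j | lookup EX i in iX | σ i FinP.≟ j
  ... | true  | yes refl | _     | _        = inj₂ iZ
  ... | _     | _        | true  | yes refl =
    inj₁ ([]=⇒lookup (proj₁ pairing i (lookup⇒[]= i EX iX)))
  ... | false | _        | false | _        with () ← e
  ... | false | _        | true  | no _     with () ← e
  ... | true  | no _     | false | _        with () ← e
  ... | true  | no _     | true  | no _     with () ← e

  diagonal-unused : ∀ {i} → flow EX EY EZ σ (xy i i) ≡ false → lookup EZ i ≡ false
  diagonal-unused {i} e with lookup EZ i in iZ | i FinP.≟ i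
  ... | false | _     = refl
  ... | true  | yes _ with () ← e
  ... | true  | no i≢i = ⊥-elim (i≢i refl)

  enter-unused-x : ∀ {w u i} → Res w u → u ≡ xN i →
                   lookup EX i ≡ false → lookup EZ i ≡ false → w ≡ s
  enter-unused-x (fwd (sx _) _)   _    _  _  = refl
  enter-unused-x (fwd (yt _) _)   ()
  enter-unused-x (fwd (xy _ _) _) ()
  enter-unused-x (bwd (sx _) _)   ()
  enter-unused-x (bwd (yt _) _)   ()
  enter-unused-x (bwd (xy i j) e) refl iX iZ with flow-source e
  ... | inj₁ iX′ with () ← trans (sym iX′) iX
  ... | inj₂ iZ′ with () ← trans (sym iZ′) iZ

  leave-unused-y : IsPairing EX EY σ → ∀ {v z j} → Res v z → v ≡ yN j →
                   lookup EY j ≡ false → lookup EZ j ≡ false → z ≡ t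
  leave-unused-y pairing (fwd (yt _) _)   _    _  _  = refl
  leave-unused-y pairing (fwd (sx _) _)   ()
  leave-unused-y pairing (fwd (xy _ _) _) ()
  leave-unused-y pairing (bwd (sx _) _)   ()
  leave-unused-y pairing (bwd (yt _) _)   ()
  leave-unused-y pairing (bwd (xy i j) e) refl jY jZ with flow-target pairing e
  ... | inj₁ jY′ with () ← trans (sym jY′) jY
  ... | inj₂ jZ′ with () ← trans (sym jZ′) jZ

  unused-index-touches-terminal : Empty (EX ∩ EY) → IsPairing EX EY σ → ∀ {w u v z i} →
    Res w u → u ≡ xN i → Res v z → v ≡ yN i → lookup EZ i ≡ false → w ≡ s ⊎ z ≡ t
  unused-index-touches-terminal disjXY pairing {i = i} into u≡xᵢ out v≡yᵢ iZ
    with lookup EX i in iX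
  ... | false = inj₁ (enter-unused-x into u≡xᵢ iX iZ)
  ... | true  = inj₂ (leave-unused-y pairing out v≡yᵢ (disjoint disjXY i iX) iZ)

  𝓕-arc-touches-terminal : Empty (EX ∩ EY) → IsPairing EX EY σ → ∀ {w u v z} →
    Res w u → Res u v → Res v z → isF u v ≡ true → w ≡ s ⊎ z ≡ t
  𝓕-arc-touches-terminal disjXY pairing into (fwd (xy i j) e) out isF≡true
    with refl ← toWitness (Equivalence.from T-≡ isF≡true) =
    unused-index-touches-terminal disjXY pairing into refl out refl (diagonal-unused e)
  𝓕-arc-touches-terminal _ _ _ (fwd (sx _) _)   _ ()
  𝓕-arc-touches-terminal _ _ _ (fwd (yt _) _)   _ ()
  𝓕-arc-touches-terminal _ _ _ (bwd (sx _) _)   _ ()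
  𝓕-arc-touches-terminal _ _ _ (bwd (yt _) _)   _ ()
  𝓕-arc-touches-terminal _ _ _ (bwd (xy _ _) _) _ ()

module Cycle {n : ℕ} {EX EY EZ : Subset n} {σ : Fin n → Fin n}
             (cyc : SimpleCycle EX EY EZ σ) where
  open SimpleCycle cyc
  open Residual EX EY EZ σ

  arcInto : (k : Fin (ℕ.suc m)) → Res (vtx (prev k)) (vtx k)
  arcInto zero    = close
  arcInto (suc j) = step j

  entersVia𝓕 : Fin (ℕ.suc m) → Bool
  entersVia𝓕 k = isF (vtx (prev k)) (vtx k)

  -- countF indexes the same arcs, listing the closing arc last
  countF≡count : countF cyc ≡ count entersVia𝓕
  countF≡count =
    ℕP.+-comm (count (λ k → entersVia𝓕 (suc k))) (if entersVia𝓕 zero then 1 else 0)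

  FromS : Fin (ℕ.suc m) → Set
  FromS k = vtx (prev (prev k)) ≡ s

  ToT : Fin (ℕ.suc m) → Set
  ToT k = ∃[ j ] (prev j ≡ k × vtx j ≡ t)

  -- s and t each occur once on a simple cycle
  fromS-atMostOne : AtMostOne FromS
  fromS-atMostOne k k′ sₖ sₖ′ =
    prev-injective k k′ (prev-injective _ _ (vtx-inj _ _ (trans sₖ (sym sₖ′))))

  toT-atMostOne : AtMostOne ToT
  toT-atMostOne k k′ (j , jₖ , tⱼ) (j′ , jₖ′ , tⱼ′) =
    trans (sym jₖ) (trans (cong prev (vtx-inj j j′ (trans tⱼ (sym tⱼ′)))) jₖ′)

  -- the local analysis, applied to the arcs entering prev k, k and the
  -- successor position j of k
  𝓕-arc-fromS-or-toT : Empty (EX ∩ EY) → IsPairing EX EY σ →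
                       ∀ k → entersVia𝓕 k ≡ true → FromS k ⊎ ToT k
  𝓕-arc-fromS-or-toT disjXY pairing k 𝓕ₖ with prev-surjective k
  ... | j , jₖ with 𝓕-arc-touches-terminal disjXY pairing (arcInto (prev k)) (arcInto k)
                      (subst (λ i → Res (vtx i) (vtx j)) jₖ (arcInto j)) 𝓕ₖ
  ...   | inj₁ fromS = inj₁ fromS
  ...   | inj₂ toT   = inj₂ (j , jₖ , toT)

lemma3 : (n p : ℕ) → 2 ≤ n → 1 ≤ p → p < n →
    (C cbar : Fin n → ℚ) → (∀ i → 0ℚ ≤ℚ C i) → (∀ i → 0ℚ ≤ℚ cbar i) →
    (θ : ℚ) → 0ℚ ≤ℚ θ →
    (k : ℕ) → k ≤ p →
    (EX EY EZ : Subset n) →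
    Empty (EX ∩ EY) → Empty (EX ∩ EZ) → Empty (EY ∩ EZ) →
    ∣ EX ∣ + ∣ EZ ∣ ≡ p → ∣ EY ∣ + ∣ EZ ∣ ≡ p →
    Optimal p k C cbar θ (χ EX) (χ EY) (χ EZ) →
    (σ : Fin n → Fin n) → IsPairing EX EY σ →
    (cyc : SimpleCycle EX EY EZ σ) → countF cyc ≤ 2
lemma3 n p _ _ _ C cbar _ _ θ _ k _ EX EY EZ disjXY _ _ _ _ _ σ pairing cyc =
  subst (_≤ 2) (sym countF≡count)
    (count-atMostTwo entersVia𝓕 FromS ToT
      (𝓕-arc-fromS-or-toT disjXY pairing) fromS-atMostOne toT-atMostOne)
  where open Cycle cyc
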